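{- Let $d\ge0$ be an integer and $K$ a group of order $2^{2d+1}$ having a central involution $g$. Suppose that $x_1,\dots,x_d,y_1,\dots,y_d\in K$ satisfy: (i) for each $i=1,\dots,d$, $T_i=1-x_i-y_i-x_iy_i\in\mathbb{Z}K$ is a perfect ternary array of modulus $2$ in $K$; (ii) $(1+g)\prod_{i=1}^d(1+x_i+y_i+x_iy_i)=\sum_{k\in K}k$ in $\mathbb{Z}K$. Let $T=\prod_{i=1}^dT_i$. Then $\{T,T\}$ is a signature set on $K$ with respect to $\langle g\rangle\cong C_2$; that is, $T$ is $\{\pm1\}$-valued on a set of coset representatives for $\langle g\rangle$ in $K$ and zero elsewhere, and $T\chi T^{(-1)}=\frac{|K|}{2}\chi$ in $\mathbb{Z}K$ for $\chi\in\{1+g,\,1-g\}$.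
   Context: Functions on $K$ are identified with elements of $\mathbb{Z}K$ via $F\leftrightarrow\sum_k F(k)k$; for $A=\sum a_k k$, $A^{(-1)}=\sum a_k k^{ -1}$. A perfect ternary array of modulus $m$ in a group $K$ is a $\{+1,0,-1\}$-valued function $T$ on $K$ with $TT^{(-1)}=m^2$ (i.e. $m^2\cdot 1_K$) in $\mathbb{Z}K$. For a normal subgroup $E=\langle g\rangle\cong C_2$ with characters $\chi_0=1+g$, $\chi_1=1-g$, a signature set on $K$ with respect to $E$ is a pair $\{A_0,A_1\}$ of elements of $\mathbb{Z}K$, each $\{\pm1\}$-valued on some set of coset representatives for $E$ in $K$ and zero elsewhere, with $A_u\chi_uA_u^{(-1)}=\frac{|K|}{2}\chi_u$ for $u\in\{0,1\}$. -}

module Defs where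

open import Data.Nat as ℕ using (ℕ; zero; suc)
open import Data.Integer as ℤ using (ℤ; +_; -_)
open import Data.Fin using (Fin; zero; suc; _≟_)
open import Data.Bool using (Bool; true; false; not; if_then_else_)
open import Data.Product using (_×_; ∃)
open import Data.Sum using (_⊎_)
open import Relation.Nullary using (¬_)
open import Relation.Nullary.Decidable using (⌊_⌋)
open import Relation.Binary.PropositionalEquality using (_≡_)
open import Algebra.Structures using (IsGroup)

-- A finite group of order n, presented on the carrier Fin n
-- (every finite group of order n is isomorphic to one of these),
-- with propositional equality.
record FinGroup (n : ℕ) : Set where
  field
    _∙_     : Fin n → Fin n → Fin n
    ε       : Fin n
    _⁻¹     : Fin n → Fin n
    isGroup : IsGroup _≡_ _∙_ ε _⁻¹

sumFin : ∀ {n} → (Fin n → ℤ) → ℤ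
sumFin {zero}  f = + 0
sumFin {suc n} f = f zero ℤ.+ sumFin (λ i → f (suc i))

-- The integral group ring ℤK, elements identified with functions K → ℤ
-- (F ↔ Σ_k F(k) k).
module GroupRing {n : ℕ} (G : FinGroup n) where
  open FinGroup G public

  ZK : Set
  ZK = Fin n → ℤ

  infix 4 _≈_
  _≈_ : ZK → ZK → Set
  A ≈ B = ∀ k → A k ≡ B k

  ⟦_⟧ : Fin n → ZK
  ⟦ k ⟧ h = if ⌊ h ≟ k ⌋ then + 1 else + 0

  one : ZK
  one = ⟦ ε ⟧

  infixl 6 _⊕_ _⊖_
  infixl 7 _⊛_ _·_
  _⊕_ : ZK → ZK → ZK
  (A ⊕ B) k = A k ℤ.+ B k

  _⊖_ : ZK → ZK → ZK
  (A ⊖ B) k = A k ℤ.- B k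

  _·_ : ℤ → ZK → ZK
  (m · A) k = m ℤ.* A k

  _⊛_ : ZK → ZK → ZK
  (A ⊛ B) k = sumFin (λ h → A h ℤ.* B ((h ⁻¹) ∙ k))

  _⁽⁻¹⁾ : ZK → ZK
  (A ⁽⁻¹⁾) k = A (k ⁻¹)

  allK : ZK
  allK _ = + 1

  prod : ∀ {d} → (Fin d → ZK) → ZK
  prod {zero}  f = one
  prod {suc d} f = f zero ⊛ prod (λ i → f (suc i))

  PerfectTernary : ZK → ℕ → Set
  PerfectTernary T m =
    (∀ k → T k ≡ + 1 ⊎ T k ≡ + 0 ⊎ T k ≡ - (+ 1))
    × (T ⊛ (T ⁽⁻¹⁾) ≈ (+ (m ℕ.* m)) · one)

  CentralInvolution : Fin n → Set
  CentralInvolution g = ¬ (g ≡ ε) × (g ∙ g ≡ ε) × (∀ h → g ∙ h ≡ h ∙ g)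

  -- R ⊆ K (as a Bool-valued predicate) is a set of coset representatives
  -- for E = ⟨g⟩ = {ε, g}: each coset {k, k g} meets R in exactly one element.
  CosetReps : Fin n → (Fin n → Bool) → Set
  CosetReps g R = ∀ k → R k ≡ not (R (k ∙ g))

  PMOnReps : Fin n → ZK → Set
  PMOnReps g A = ∃ λ R → CosetReps g R ×
    (∀ k → (R k ≡ true → A k ≡ + 1 ⊎ A k ≡ - (+ 1)) × (R k ≡ false → A k ≡ + 0))

  χ₀ : Fin n → ZK
  χ₀ g = one ⊕ ⟦ g ⟧

  χ₁ : Fin n → ZK
  χ₁ g = one ⊖ ⟦ g ⟧

  SignatureSet : Fin n → ZK → ZK → Set
  SignatureSet g A₀ A₁ =
    PMOnReps g A₀ × PMOnReps g A₁
    × (A₀ ⊛ χ₀ g ⊛ (A₀ ⁽⁻¹⁾) ≈ (+ (n ℕ./ 2)) · χ₀ g)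
    × (A₁ ⊛ χ₁ g ⊛ (A₁ ⁽⁻¹⁾) ≈ (+ (n ℕ./ 2)) · χ₁ g)

-- Every Tᵢ = 1 − xᵢ − yᵢ − xᵢyᵢ has TᵢTᵢ⁽⁻¹⁾ = 4, and the norm A A⁽⁻¹⁾ is multiplicative
-- once it is scalar, so T T⁽⁻¹⁾ = 4ᵈ = |K|/2. Both characters 1 ± g are central in ℤK
-- (g is central), hence T χ T⁽⁻¹⁾ = χ T T⁽⁻¹⁾ = (|K|/2) χ.
-- For the support, T is obtained from S = ∏ (1 + xᵢ + yᵢ + xᵢyᵢ) by choosing a sign for
-- every term of the expanded product, so each coefficient of T is a signed sum of as many
-- units as the coefficient of S counts. The hypothesis (1 + g) S = Σ_K k says that
-- S(k) + S(kg) = 1 with S ≥ 0, i.e. S is the indicator of a set of coset representatives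
-- of ⟨g⟩; there T is ±1, elsewhere 0.
module Submission where

open import Defs
open import Data.Nat using (ℕ; _^_; _*_; _+_)
open import Data.Fin using (Fin)

import Data.Nat as ℕ
import Data.Nat.Properties as ℕₚ
open import Data.Nat.DivMod using (_/_; m*n/n≡m)
open import Data.Nat.Tactic.RingSolver as ℕ-Solver using ()
open import Data.Fin using (zero; suc; _≟_)
open import Data.Fin.Permutation using (permutation)
open import Data.Integer as ℤ using (ℤ; +_; -_)
import Data.Integer.Properties as ℤₚ
open import Data.Integer.Tactic.RingSolver using (solve-∀)
open import Data.Bool using (Bool; true; false; not; if_then_else_)
open import Data.Product using (_×_; _,_; proj₂)
open import Data.Sum using (_⊎_; inj₁; inj₂)
open import Function using (_∘_)
open import Relation.Nullary using (yes; no; contradiction)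
open import Relation.Nullary.Decidable using (⌊_⌋)
open import Relation.Binary.PropositionalEquality
open import Algebra.Structures using (IsGroup)
open import Algebra.Bundles using (Group)
import Algebra.Properties.Group as GroupProperties
import Algebra.Properties.Semiring.Sum as SemiringSum
open import Algebra.Properties.CommutativeSemigroup ℤₚ.*-commutativeSemigroup using (x∙yz≈y∙xz)
import Relation.Binary.Reasoning.Setoid as SetoidReasoning

module Σℤ = SemiringSum ℤₚ.+-*-semiring

sumFin≗sum : ∀ {n} (f : Fin n → ℤ) → sumFin f ≡ Σℤ.sum f
sumFin≗sum {ℕ.zero}  f = refl
sumFin≗sum {ℕ.suc n} f = cong (λ s → f zero ℤ.+ s) (sumFin≗sum (f ∘ suc))

sumFin-via-sum : ∀ {m n} (f : Fin m → ℤ) (g : Fin n → ℤ) →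
  Σℤ.sum f ≡ Σℤ.sum g → sumFin f ≡ sumFin g
sumFin-via-sum f g e = trans (sumFin≗sum f) (trans e (sym (sumFin≗sum g)))

sumFin-cong : ∀ {n} {f g : Fin n → ℤ} → (∀ i → f i ≡ g i) → sumFin f ≡ sumFin g
sumFin-cong {f = f} {g} e = sumFin-via-sum f g (Σℤ.sum-cong-≗ e)

sumFin-+ : ∀ {n} (f g : Fin n → ℤ) →
  sumFin (λ i → f i ℤ.+ g i) ≡ sumFin f ℤ.+ sumFin g
sumFin-+ f g = trans (sumFin≗sum (λ i → f i ℤ.+ g i))
  (trans (Σℤ.∑-distrib-+ f g) (sym (cong₂ ℤ._+_ (sumFin≗sum f) (sumFin≗sum g))))

*-distribˡ-sumFin : ∀ {n} c (f : Fin n → ℤ) →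
  c ℤ.* sumFin f ≡ sumFin (λ i → c ℤ.* f i)
*-distribˡ-sumFin c f = trans (cong (c ℤ.*_) (sumFin≗sum f))
  (trans (Σℤ.*-distribˡ-sum c f) (sym (sumFin≗sum (λ i → c ℤ.* f i))))

*-distribʳ-sumFin : ∀ {n} c (f : Fin n → ℤ) →
  sumFin f ℤ.* c ≡ sumFin (λ i → f i ℤ.* c)
*-distribʳ-sumFin c f = trans (cong (ℤ._* c) (sumFin≗sum f))
  (trans (Σℤ.*-distribʳ-sum c f) (sym (sumFin≗sum (λ i → f i ℤ.* c))))

sumFin-comm : ∀ {m n} (f : Fin m → Fin n → ℤ) →
  sumFin (λ i → sumFin (f i)) ≡ sumFin (λ j → sumFin (λ i → f i j))
sumFin-comm f = begin
  sumFin (λ i → sumFin (f i))              ≡⟨ sumFin-cong (sumFin≗sum ∘ f) ⟩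
  sumFin (λ i → Σℤ.sum (f i))
    ≡⟨ sumFin-via-sum (λ i → Σℤ.sum (f i)) (λ j → Σℤ.sum (λ i → f i j)) (Σℤ.∑-comm f) ⟩
  sumFin (λ j → Σℤ.sum (λ i → f i j))      ≡⟨ sumFin-cong (λ j → sym (sumFin≗sum (λ i → f i j))) ⟩
  sumFin (λ j → sumFin (λ i → f i j))      ∎
  where open ≡-Reasoning

sumFin-permute : ∀ {n} (f : Fin n → ℤ) (σ τ : Fin n → Fin n) →
  (∀ i → σ (τ i) ≡ i) → (∀ i → τ (σ i) ≡ i) → sumFin f ≡ sumFin (f ∘ σ)
sumFin-permute f σ τ στ τσ = sumFin-via-sum f (f ∘ σ) (Σℤ.sum-permute f (permutation σ τ στ τσ))

-- In every group ring on Fin n, ⟦ b ⟧ unfolds to indicator b.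
indicator : ∀ {n} → Fin n → Fin n → ℤ
indicator b h = if ⌊ h ≟ b ⌋ then + 1 else + 0

indicator-cong : ∀ {m n} {a b : Fin m} {c d : Fin n} → (a ≡ b → c ≡ d) → (c ≡ d → a ≡ b) →
  indicator b a ≡ indicator d c
indicator-cong {a = a} {b} {c} {d} to from with a ≟ b | c ≟ d
... | yes _   | yes _   = refl
... | no _    | no _    = refl
... | yes a≡b | no c≢d  = contradiction (to a≡b) c≢d
... | no a≢b  | yes c≡d = contradiction (from c≡d) a≢b

sumFin-indicator : ∀ {n} (b : Fin n) (f : Fin n → ℤ) →
  sumFin (λ h → indicator b h ℤ.* f h) ≡ f b
sumFin-indicator {ℕ.suc n} zero f = begin
  + 1 ℤ.* f zero ℤ.+ sumFin (λ i → + 0 ℤ.* f (suc i))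
    ≡⟨ cong₂ ℤ._+_ (ℤₚ.*-identityˡ (f zero)) sum-of-zeros ⟩
  f zero ℤ.+ + 0 ≡⟨ ℤₚ.+-identityʳ (f zero) ⟩
  f zero ∎
  where
  open ≡-Reasoning
  sum-of-zeros : sumFin (λ (_ : Fin n) → + 0) ≡ + 0
  sum-of-zeros =
    sumFin-via-sum (λ (_ : Fin n) → + 0) (λ (_ : Fin 0) → + 0) (Σℤ.sum-replicate-zero n)
sumFin-indicator {ℕ.suc n} (suc b) f = begin
  + 0 ℤ.* f zero ℤ.+ sumFin (λ i → indicator (suc b) (suc i) ℤ.* f (suc i))
    ≡⟨ ℤₚ.+-identityˡ _ ⟩
  sumFin (λ i → indicator (suc b) (suc i) ℤ.* f (suc i))
    ≡⟨ sumFin-cong (λ i → cong (ℤ._* f (suc i))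
                                (indicator-cong {c = i} {b} suc-injective (cong suc))) ⟩
  sumFin (λ i → indicator b i ℤ.* f (suc i))
    ≡⟨ sumFin-indicator b (f ∘ suc) ⟩
  f (suc b) ∎
  where
  open ≡-Reasoning
  open import Data.Fin.Properties using (suc-injective)

-- a ≼ b : for some p, q ∈ ℕ, b = p + q and a = p − q, i.e. a is a signed sum of b units.
infix 4 _≼_
record _≼_ (a b : ℤ) : Set where
  constructor signs
  field
    positive negative : ℕ
    total      : b ≡ + (positive + negative)
    difference : a ≡ + positive ℤ.- + negative

≼-refl⁺ : ∀ m → + m ≼ + m
≼-refl⁺ m = signs m 0 m≡m+0 m≡m+0
  where
  m≡m+0 : + m ≡ + (m + 0)
  m≡m+0 = cong +_ (sym (ℕₚ.+-identityʳ m))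

≼-neg : ∀ {a b} → a ≼ b → - a ≼ b
≼-neg (signs p q refl refl) = signs q p (cong +_ (ℕₚ.+-comm p q)) (neg-diff (+ p) (+ q))
  where
  neg-diff : ∀ x y → - (x ℤ.- y) ≡ y ℤ.- x
  neg-diff = solve-∀

≼-+ : ∀ {a b c d} → a ≼ b → c ≼ d → a ℤ.+ c ≼ b ℤ.+ d
≼-+ (signs p q refl refl) (signs p′ q′ refl refl) =
  signs (p + p′) (q + q′) (cong +_ (interchange p q p′ q′)) (diff-+ (+ p) (+ q) (+ p′) (+ q′))
  where
  interchange : ∀ w x y z → (w + x) + (y + z) ≡ (w + y) + (x + z)
  interchange = ℕ-Solver.solve-∀
  diff-+ : ∀ w x y z → (w ℤ.- x) ℤ.+ (y ℤ.- z) ≡ (w ℤ.+ y) ℤ.- (x ℤ.+ z)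
  diff-+ = solve-∀

≼-* : ∀ {a b c d} → a ≼ b → c ≼ d → a ℤ.* c ≼ b ℤ.* d
≼-* (signs p q refl refl) (signs p′ q′ refl refl) =
  signs (p * p′ + q * q′) (p * q′ + q * p′)
    (trans (sym (ℤₚ.pos-* (p + q) (p′ + q′))) (cong +_ (expand p q p′ q′)))
    (trans (diff-* (+ p) (+ q) (+ p′) (+ q′))
      (cong₂ ℤ._-_ (cong₂ ℤ._+_ (pos p p′) (pos q q′)) (cong₂ ℤ._+_ (pos p q′) (pos q p′))))
  where
  expand : ∀ w x y z → (w + x) * (y + z) ≡ (w * y + x * z) + (w * z + x * y)
  expand = ℕ-Solver.solve-∀
  diff-* : ∀ w x y z →
    (w ℤ.- x) ℤ.* (y ℤ.- z) ≡ (w ℤ.* y ℤ.+ x ℤ.* z) ℤ.- (w ℤ.* z ℤ.+ x ℤ.* y)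
  diff-* = solve-∀
  pos : ∀ m n → + m ℤ.* + n ≡ + (m * n)
  pos m n = sym (ℤₚ.pos-* m n)

sumFin-≼ : ∀ {n} {f g : Fin n → ℤ} → (∀ i → f i ≼ g i) → sumFin f ≼ sumFin g
sumFin-≼ {ℕ.zero}  f≼g = ≼-refl⁺ 0
sumFin-≼ {ℕ.suc n} f≼g = ≼-+ (f≼g zero) (sumFin-≼ (f≼g ∘ suc))

indicator-≼ : ∀ {n} (b h : Fin n) → indicator b h ≼ indicator b h
indicator-≼ b h with ⌊ h ≟ b ⌋
... | true  = ≼-refl⁺ 1
... | false = ≼-refl⁺ 0

≼-zero : ∀ {a} → a ≼ + 0 → a ≡ + 0
≼-zero (signs 0 0 _ a≡0) = a≡0
≼-zero (signs 0 (ℕ.suc _) () _)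
≼-zero (signs (ℕ.suc _) _ () _)

≼-one : ∀ {a} → a ≼ + 1 → a ≡ + 1 ⊎ a ≡ - + 1
≼-one (signs 1 0 _ a≡1) = inj₁ a≡1
≼-one (signs 0 1 _ a≡-1) = inj₂ a≡-1
≼-one (signs 0 0 () _)
≼-one (signs 0 (ℕ.suc (ℕ.suc _)) () _)
≼-one (signs 1 (ℕ.suc _) () _)
≼-one (signs (ℕ.suc (ℕ.suc _)) _ () _)

sum-of-naturals≡1 : ∀ {b c : ℤ} {p q : ℕ} → b ≡ + p → c ≡ + q → b ℤ.+ c ≡ + 1 →
  (b ≡ + 1 × c ≡ + 0) ⊎ (b ≡ + 0 × c ≡ + 1)
sum-of-naturals≡1 {p = 1} {0} refl refl _ = inj₁ (refl , refl)
sum-of-naturals≡1 {p = 0} {1} refl refl _ = inj₂ (refl , refl)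
sum-of-naturals≡1 {p = 0} {0} refl refl ()
sum-of-naturals≡1 {p = 0} {ℕ.suc (ℕ.suc _)} refl refl ()
sum-of-naturals≡1 {p = 1} {ℕ.suc _} refl refl ()
sum-of-naturals≡1 {p = ℕ.suc (ℕ.suc _)} refl refl ()

module GroupRingLaws {n : ℕ} (G : FinGroup n) where
  open GroupRing G
  open IsGroup isGroup using (assoc; identityˡ; identityʳ)

  group : Group _ _
  group = record { isGroup = isGroup }

  open GroupProperties group
    using (ε⁻¹≈ε; ⁻¹-involutive; ⁻¹-anti-homo-∙; inverseʳ-unique;
           \\-leftDividesˡ; \\-leftDividesʳ; //-rightDividesˡ)
  module ≈-Reasoning = SetoidReasoning (Fin n →-setoid ℤ)

  ≈-sym : ∀ {A B} → A ≈ B → B ≈ A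
  ≈-sym A≈B k = sym (A≈B k)

  Central : Fin n → Set
  Central c = ∀ h → c ∙ h ≡ h ∙ c

  IsClassFunction : ZK → Set
  IsClassFunction C = ∀ h k → C (h ∙ k) ≡ C (k ∙ h)

  [x∙y]⁻¹∙x≡y⁻¹ : ∀ x y → ((x ∙ y) ⁻¹) ∙ x ≡ y ⁻¹
  [x∙y]⁻¹∙x≡y⁻¹ x y = trans (cong (_∙ x) (⁻¹-anti-homo-∙ x y)) (//-rightDividesˡ x (y ⁻¹))

  sumFin-translate : ∀ u (f : Fin n → ℤ) → sumFin f ≡ sumFin (λ h → f (u ∙ h))
  sumFin-translate u f = sumFin-permute f (u ∙_) ((u ⁻¹) ∙_) (\\-leftDividesˡ u) (\\-leftDividesʳ u)

  sumFin-invert : ∀ (f : Fin n → ℤ) → sumFin f ≡ sumFin (λ h → f (h ⁻¹))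
  sumFin-invert f = sumFin-permute f _⁻¹ _⁻¹ ⁻¹-involutive ⁻¹-involutive

  ⊛-congˡ : ∀ {A A′} B → A ≈ A′ → A ⊛ B ≈ A′ ⊛ B
  ⊛-congˡ B A≈A′ k = sumFin-cong (λ h → cong (ℤ._* B ((h ⁻¹) ∙ k)) (A≈A′ h))

  ⊛-congʳ : ∀ A {B B′} → B ≈ B′ → A ⊛ B ≈ A ⊛ B′
  ⊛-congʳ A B≈B′ k = sumFin-cong (λ h → cong (A h ℤ.*_) (B≈B′ ((h ⁻¹) ∙ k)))

  ⟦⟧-⊛ : ∀ u A k → (⟦ u ⟧ ⊛ A) k ≡ A ((u ⁻¹) ∙ k)
  ⟦⟧-⊛ u A k = sumFin-indicator u (λ h → A ((h ⁻¹) ∙ k))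

  ⊛-identityˡ : ∀ A → one ⊛ A ≈ A
  ⊛-identityˡ A k = trans (⟦⟧-⊛ ε A k) (cong A (trans (cong (_∙ k) ε⁻¹≈ε) (identityˡ k)))

  ⊛-distribʳ-⊕ : ∀ A B C → (A ⊕ B) ⊛ C ≈ A ⊛ C ⊕ B ⊛ C
  ⊛-distribʳ-⊕ A B C k =
    trans (sumFin-cong (λ h → ℤₚ.*-distribʳ-+ (C ((h ⁻¹) ∙ k)) (A h) (B h)))
          (sumFin-+ (λ h → A h ℤ.* C ((h ⁻¹) ∙ k)) (λ h → B h ℤ.* C ((h ⁻¹) ∙ k)))

  ⊛-· : ∀ c A B → A ⊛ (c · B) ≈ c · (A ⊛ B)
  ⊛-· c A B k = trans (sumFin-cong (λ h → x∙yz≈y∙xz (A h) c (B ((h ⁻¹) ∙ k))))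
    (sym (*-distribˡ-sumFin c (λ h → A h ℤ.* B ((h ⁻¹) ∙ k))))

  ·-assoc : ∀ a b A → a · (b · A) ≈ (a ℤ.* b) · A
  ·-assoc a b A k = sym (ℤₚ.*-assoc a b (A k))

  ⊛-assoc : ∀ A B C → (A ⊛ B) ⊛ C ≈ A ⊛ (B ⊛ C)
  ⊛-assoc A B C k = begin
    sumFin (λ h → sumFin (λ u → A u ℤ.* b u h) ℤ.* c h)
      ≡⟨ sumFin-cong (λ h → *-distribʳ-sumFin (c h) (λ u → A u ℤ.* b u h)) ⟩
    sumFin (λ h → sumFin (λ u → A u ℤ.* b u h ℤ.* c h))
      ≡⟨ sumFin-comm (λ h u → A u ℤ.* b u h ℤ.* c h) ⟩
    sumFin (λ u → sumFin (λ h → A u ℤ.* b u h ℤ.* c h))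
      ≡⟨ sumFin-cong (λ u → sumFin-cong (λ h → ℤₚ.*-assoc (A u) (b u h) (c h))) ⟩
    sumFin (λ u → sumFin (λ h → A u ℤ.* (b u h ℤ.* c h)))
      ≡⟨ sumFin-cong (λ u → sym (*-distribˡ-sumFin (A u) (λ h → b u h ℤ.* c h))) ⟩
    sumFin (λ u → A u ℤ.* sumFin (λ h → b u h ℤ.* c h))
      ≡⟨ sumFin-cong (λ u → cong (A u ℤ.*_) (inner u)) ⟩
    (A ⊛ (B ⊛ C)) k ∎
    where
    open ≡-Reasoning
    b : Fin n → Fin n → ℤ
    b u h = B ((u ⁻¹) ∙ h)
    c : Fin n → ℤ
    c h = C ((h ⁻¹) ∙ k)
    [u∙v]⁻¹∙k : ∀ u v → ((u ∙ v) ⁻¹) ∙ k ≡ (v ⁻¹) ∙ ((u ⁻¹) ∙ k)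
    [u∙v]⁻¹∙k u v = trans (cong (_∙ k) (⁻¹-anti-homo-∙ u v)) (assoc (v ⁻¹) (u ⁻¹) k)
    inner : ∀ u → sumFin (λ h → b u h ℤ.* c h) ≡ sumFin (λ v → B v ℤ.* C ((v ⁻¹) ∙ ((u ⁻¹) ∙ k)))
    inner u = trans (sumFin-translate u (λ h → b u h ℤ.* c h))
      (sumFin-cong (λ v → cong₂ ℤ._*_ (cong B (\\-leftDividesʳ u v)) (cong C ([u∙v]⁻¹∙k u v))))

  ⁽⁻¹⁾-anti : ∀ A B → (A ⊛ B) ⁽⁻¹⁾ ≈ (B ⁽⁻¹⁾) ⊛ (A ⁽⁻¹⁾)
  ⁽⁻¹⁾-anti A B k = sym (begin
    ((B ⁽⁻¹⁾) ⊛ (A ⁽⁻¹⁾)) k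
      ≡⟨ sumFin-translate k (λ h → B (h ⁻¹) ℤ.* A ((((h ⁻¹) ∙ k)) ⁻¹)) ⟩
    sumFin (λ h → B ((k ∙ h) ⁻¹) ℤ.* A ((((k ∙ h) ⁻¹) ∙ k) ⁻¹))
      ≡⟨ sumFin-cong term ⟩
    ((A ⊛ B) ⁽⁻¹⁾) k ∎)
    where
    open ≡-Reasoning
    term : ∀ h → B ((k ∙ h) ⁻¹) ℤ.* A ((((k ∙ h) ⁻¹) ∙ k) ⁻¹) ≡ A h ℤ.* B ((h ⁻¹) ∙ (k ⁻¹))
    term h = trans (ℤₚ.*-comm (B ((k ∙ h) ⁻¹)) (A ((((k ∙ h) ⁻¹) ∙ k) ⁻¹))) (cong₂ ℤ._*_
      (cong A (trans (cong _⁻¹ ([x∙y]⁻¹∙x≡y⁻¹ k h)) (⁻¹-involutive h)))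
      (cong B (⁻¹-anti-homo-∙ k h)))

  ⊛-comm-classFunction : ∀ C → IsClassFunction C → ∀ A → C ⊛ A ≈ A ⊛ C
  ⊛-comm-classFunction C C-class A k = begin
    (C ⊛ A) k
      ≡⟨ sumFin-translate k (λ h → C h ℤ.* A ((h ⁻¹) ∙ k)) ⟩
    sumFin (λ h → C (k ∙ h) ℤ.* A (((k ∙ h) ⁻¹) ∙ k))
      ≡⟨ sumFin-cong (λ h → cong (λ v → C (k ∙ h) ℤ.* A v) ([x∙y]⁻¹∙x≡y⁻¹ k h)) ⟩
    sumFin (λ h → C (k ∙ h) ℤ.* A (h ⁻¹))
      ≡⟨ sumFin-invert (λ h → C (k ∙ h) ℤ.* A (h ⁻¹)) ⟩
    sumFin (λ h → C (k ∙ (h ⁻¹)) ℤ.* A ((h ⁻¹) ⁻¹))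
      ≡⟨ sumFin-cong (λ h → trans (ℤₚ.*-comm (C (k ∙ (h ⁻¹))) (A ((h ⁻¹) ⁻¹)))
           (cong₂ ℤ._*_ (cong A (⁻¹-involutive h)) (C-class k (h ⁻¹)))) ⟩
    (A ⊛ C) k ∎
    where open ≡-Reasoning

  central-swap : ∀ {c} → Central c → ∀ h k → h ∙ k ≡ c → k ∙ h ≡ c
  central-swap {c} c-central h k h∙k≡c = begin
    k ∙ h                   ≡⟨ cong (_∙ h) (sym (\\-leftDividesʳ h k)) ⟩
    ((h ⁻¹) ∙ (h ∙ k)) ∙ h  ≡⟨ cong (λ v → ((h ⁻¹) ∙ v) ∙ h) h∙k≡c ⟩
    ((h ⁻¹) ∙ c) ∙ h        ≡⟨ assoc (h ⁻¹) c h ⟩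
    (h ⁻¹) ∙ (c ∙ h)        ≡⟨ cong ((h ⁻¹) ∙_) (c-central h) ⟩
    (h ⁻¹) ∙ (h ∙ c)        ≡⟨ \\-leftDividesʳ h c ⟩
    c                       ∎
    where open ≡-Reasoning

  ⟦⟧-classFunction : ∀ {c} → Central c → IsClassFunction ⟦ c ⟧
  ⟦⟧-classFunction c-central h k =
    indicator-cong (central-swap c-central h k) (central-swap c-central k h)

  ε-central : Central ε
  ε-central h = trans (identityˡ h) (sym (identityʳ h))

  one-classFunction : IsClassFunction one
  one-classFunction = ⟦⟧-classFunction {ε} ε-central

  ·-classFunction : ∀ c C → IsClassFunction C → IsClassFunction (c · C)
  ·-classFunction c C C-class h k = cong (c ℤ.*_) (C-class h k)

  χ₀-classFunction : ∀ {g} → Central g → IsClassFunction (χ₀ g)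
  χ₀-classFunction g-central h k =
    cong₂ ℤ._+_ (one-classFunction h k) (⟦⟧-classFunction g-central h k)

  χ₁-classFunction : ∀ {g} → Central g → IsClassFunction (χ₁ g)
  χ₁-classFunction g-central h k =
    cong₂ ℤ._-_ (one-classFunction h k) (⟦⟧-classFunction g-central h k)

  ⊛-identityʳ : ∀ A → A ⊛ one ≈ A
  ⊛-identityʳ A k = trans (sym (⊛-comm-classFunction one one-classFunction A k)) (⊛-identityˡ A k)

  one⁽⁻¹⁾ : one ⁽⁻¹⁾ ≈ one
  one⁽⁻¹⁾ k = indicator-cong
    (λ k⁻¹≡ε → trans (sym (⁻¹-involutive k)) (trans (cong _⁻¹ k⁻¹≡ε) ε⁻¹≈ε))
    (λ k≡ε → trans (cong _⁻¹ k≡ε) ε⁻¹≈ε)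

  classFunction-conjugate : ∀ C → IsClassFunction C → ∀ A a →
    A ⊛ (A ⁽⁻¹⁾) ≈ a · one → A ⊛ C ⊛ (A ⁽⁻¹⁾) ≈ a · C
  classFunction-conjugate C C-class A a A-norm = begin
    A ⊛ C ⊛ (A ⁽⁻¹⁾)    ≈⟨ ⊛-congˡ (A ⁽⁻¹⁾) (≈-sym (⊛-comm-classFunction C C-class A)) ⟩
    C ⊛ A ⊛ (A ⁽⁻¹⁾)    ≈⟨ ⊛-assoc C A (A ⁽⁻¹⁾) ⟩
    C ⊛ (A ⊛ (A ⁽⁻¹⁾))  ≈⟨ ⊛-congʳ C A-norm ⟩
    C ⊛ (a · one)       ≈⟨ ⊛-· a C one ⟩
    a · (C ⊛ one)       ≈⟨ (λ k → cong (a ℤ.*_) (⊛-identityʳ C k)) ⟩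
    a · C               ∎
    where open ≈-Reasoning

  ⊛-norm : ∀ A B a b → A ⊛ (A ⁽⁻¹⁾) ≈ a · one → B ⊛ (B ⁽⁻¹⁾) ≈ b · one →
    (A ⊛ B) ⊛ ((A ⊛ B) ⁽⁻¹⁾) ≈ (a ℤ.* b) · one
  ⊛-norm A B a b A-norm B-norm = begin
    (A ⊛ B) ⊛ ((A ⊛ B) ⁽⁻¹⁾)            ≈⟨ ⊛-congʳ (A ⊛ B) (⁽⁻¹⁾-anti A B) ⟩
    (A ⊛ B) ⊛ ((B ⁽⁻¹⁾) ⊛ (A ⁽⁻¹⁾))     ≈⟨ ≈-sym (⊛-assoc (A ⊛ B) (B ⁽⁻¹⁾) (A ⁽⁻¹⁾)) ⟩
    A ⊛ B ⊛ (B ⁽⁻¹⁾) ⊛ (A ⁽⁻¹⁾)         ≈⟨ ⊛-congˡ (A ⁽⁻¹⁾) (⊛-assoc A B (B ⁽⁻¹⁾)) ⟩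
    A ⊛ (B ⊛ (B ⁽⁻¹⁾)) ⊛ (A ⁽⁻¹⁾)       ≈⟨ ⊛-congˡ (A ⁽⁻¹⁾) (⊛-congʳ A B-norm) ⟩
    A ⊛ (b · one) ⊛ (A ⁽⁻¹⁾)
      ≈⟨ classFunction-conjugate (b · one) (·-classFunction b one one-classFunction) A a A-norm ⟩
    a · (b · one)                        ≈⟨ ·-assoc a b one ⟩
    (a ℤ.* b) · one                      ∎
    where open ≈-Reasoning

  prod-norm : ∀ {d} (f : Fin d → ZK) {c : ℕ} →
    (∀ i → f i ⊛ (f i ⁽⁻¹⁾) ≈ (+ c) · one) → prod f ⊛ (prod f ⁽⁻¹⁾) ≈ (+ (c ^ d)) · one
  prod-norm {ℕ.zero} f _ k = begin
    (one ⊛ (one ⁽⁻¹⁾)) k  ≡⟨ ⊛-congʳ one one⁽⁻¹⁾ k ⟩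
    (one ⊛ one) k         ≡⟨ ⊛-identityˡ one k ⟩
    one k                 ≡⟨ sym (ℤₚ.*-identityˡ (one k)) ⟩
    + 1 ℤ.* one k         ∎
    where open ≡-Reasoning
  prod-norm {ℕ.suc d} f {c} f-norm k =
    trans (⊛-norm (f zero) (prod (f ∘ suc)) (+ c) (+ (c ^ d))
                  (f-norm zero) (prod-norm (f ∘ suc) (f-norm ∘ suc)) k)
          (cong (ℤ._* one k) (sym (ℤₚ.pos-* c (c ^ d))))

  ⊛-≼ : ∀ {A A′ B B′} → (∀ k → A k ≼ A′ k) → (∀ k → B k ≼ B′ k) → ∀ k → (A ⊛ B) k ≼ (A′ ⊛ B′) k
  ⊛-≼ A≼A′ B≼B′ k = sumFin-≼ (λ h → ≼-* (A≼A′ h) (B≼B′ ((h ⁻¹) ∙ k)))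

  prod-≼ : ∀ {d} {f f′ : Fin d → ZK} → (∀ i k → f i k ≼ f′ i k) → ∀ k → prod f k ≼ prod f′ k
  prod-≼ {ℕ.zero}  _    = indicator-≼ ε
  prod-≼ {ℕ.suc d} f≼f′ = ⊛-≼ (f≼f′ zero) (prod-≼ (f≼f′ ∘ suc))

  module _ {g : Fin n} (g-central : Central g) (g∙g≡ε : g ∙ g ≡ ε) where

    χ₀-⊛ : ∀ S k → (χ₀ g ⊛ S) k ≡ S k ℤ.+ S (k ∙ g)
    χ₀-⊛ S k = trans (⊛-distribʳ-⊕ one ⟦ g ⟧ S k)
      (cong₂ ℤ._+_ (⊛-identityˡ S k) (trans (⟦⟧-⊛ g S k) (cong S g⁻¹∙k≡k∙g)))
      where
      g⁻¹∙k≡k∙g : (g ⁻¹) ∙ k ≡ k ∙ g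
      g⁻¹∙k≡k∙g = trans (cong (_∙ k) (sym (inverseʳ-unique g g g∙g≡ε))) (g-central k)

    signed-on-cosetReps : ∀ {T S} → (∀ k → T k ≼ S k) → χ₀ g ⊛ S ≈ allK → PMOnReps g T
    signed-on-cosetReps {T} {S} T≼S cover = R , R-cosetReps , T-values
      where
      S-split : ∀ k → (S k ≡ + 1 × S (k ∙ g) ≡ + 0) ⊎ (S k ≡ + 0 × S (k ∙ g) ≡ + 1)
      S-split k = sum-of-naturals≡1 (_≼_.total (T≼S k)) (_≼_.total (T≼S (k ∙ g)))
        (trans (sym (χ₀-⊛ S k)) (cover k))

      R : Fin n → Bool
      R k = ⌊ S k ℤₚ.≟ + 1 ⌋

      R-true : ∀ {k} → S k ≡ + 1 → R k ≡ true
      R-true Sk≡1 = cong (λ s → ⌊ s ℤₚ.≟ + 1 ⌋) Sk≡1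

      R-false : ∀ {k} → S k ≡ + 0 → R k ≡ false
      R-false Sk≡0 = cong (λ s → ⌊ s ℤₚ.≟ + 1 ⌋) Sk≡0

      R-cosetReps : CosetReps g R
      R-cosetReps k with S-split k
      ... | inj₁ (Sk≡1 , Skg≡0) = trans (R-true Sk≡1) (cong not (sym (R-false Skg≡0)))
      ... | inj₂ (Sk≡0 , Skg≡1) = trans (R-false Sk≡0) (cong not (sym (R-true Skg≡1)))

      T-values : ∀ k → (R k ≡ true → T k ≡ + 1 ⊎ T k ≡ - (+ 1)) × (R k ≡ false → T k ≡ + 0)
      T-values k with S-split k
      ... | inj₁ (Sk≡1 , _) =
        (λ _ → ≼-one (subst (T k ≼_) Sk≡1 (T≼S k))) ,
        (λ Rk≡false → contradiction (trans (sym (R-true Sk≡1)) Rk≡false) λ ())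
      ... | inj₂ (Sk≡0 , _) =
        (λ Rk≡true → contradiction (trans (sym Rk≡true) (R-false Sk≡0)) λ ()) ,
        (λ _ → ≼-zero (subst (T k ≼_) Sk≡0 (T≼S k)))

2^[2d+1]/2≡4^d : ∀ d → 2 ^ (2 * d + 1) / 2 ≡ 4 ^ d
2^[2d+1]/2≡4^d d = begin
  2 ^ (2 * d + 1) / 2     ≡⟨ cong (_/ 2) (ℕₚ.^-distribˡ-+-* 2 (2 * d) 1) ⟩
  2 ^ (2 * d) * 2 ^ 1 / 2 ≡⟨ cong (λ m → m * 2 / 2) (sym (ℕₚ.^-*-assoc 2 2 d)) ⟩
  4 ^ d * 2 / 2           ≡⟨ m*n/n≡m (4 ^ d) 2 ⟩
  4 ^ d                   ∎
  where open ≡-Reasoning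

proposition4p7 : (d : ℕ) (G : FinGroup (2 ^ (2 * d + 1))) →
    let open GroupRing G in
    (g : Fin (2 ^ (2 * d + 1))) → CentralInvolution g →
    (x y : Fin d → Fin (2 ^ (2 * d + 1))) →
    (∀ i → PerfectTernary (one ⊖ ⟦ x i ⟧ ⊖ ⟦ y i ⟧ ⊖ ⟦ x i ∙ y i ⟧) 2) →
    (χ₀ g ⊛ prod (λ i → one ⊕ ⟦ x i ⟧ ⊕ ⟦ y i ⟧ ⊕ ⟦ x i ∙ y i ⟧) ≈ allK) →
    SignatureSet g
      (prod (λ i → one ⊖ ⟦ x i ⟧ ⊖ ⟦ y i ⟧ ⊖ ⟦ x i ∙ y i ⟧))
      (prod (λ i → one ⊖ ⟦ x i ⟧ ⊖ ⟦ y i ⟧ ⊖ ⟦ x i ∙ y i ⟧))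
proposition4p7 d G g (_ , g∙g≡ε , g-central) x y perfect cover =
  signed , signed ,
  classFunction-conjugate (χ₀ g) (χ₀-classFunction g-central) (prod Tᵢ) |K|/2 T-norm ,
  classFunction-conjugate (χ₁ g) (χ₁-classFunction g-central) (prod Tᵢ) |K|/2 T-norm
  where
  open GroupRing G
  open GroupRingLaws G
  Tᵢ Sᵢ : Fin d → ZK
  Tᵢ i = one ⊖ ⟦ x i ⟧ ⊖ ⟦ y i ⟧ ⊖ ⟦ x i ∙ y i ⟧
  Sᵢ i = one ⊕ ⟦ x i ⟧ ⊕ ⟦ y i ⟧ ⊕ ⟦ x i ∙ y i ⟧

  Tᵢ≼Sᵢ : ∀ i k → Tᵢ i k ≼ Sᵢ i k
  Tᵢ≼Sᵢ i k = ≼-+ (≼-+ (≼-+ (indicator-≼ ε k) (≼-neg (indicator-≼ (x i) k)))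
    (≼-neg (indicator-≼ (y i) k))) (≼-neg (indicator-≼ (x i ∙ y i) k))

  signed : PMOnReps g (prod Tᵢ)
  signed = signed-on-cosetReps g-central g∙g≡ε (prod-≼ Tᵢ≼Sᵢ) cover

  |K|/2 : ℤ
  |K|/2 = + (2 ^ (2 * d + 1) / 2)

  T-norm : prod Tᵢ ⊛ (prod Tᵢ ⁽⁻¹⁾) ≈ |K|/2 · one
  T-norm k = trans (prod-norm Tᵢ (proj₂ ∘ perfect) k)
    (cong (λ m → + m ℤ.* one k) (sym (2^[2d+1]/2≡4^d d)))
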